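{- Let $\varphi$ be a satisfiable double Horn formula over variables $x_1,\dots,x_n$, let $\mathcal S\subseteq\{0,1\}^n$ be its set of satisfying assignments (as vectors), and let $k$ be a positive integer. Then there exist $\mathbf x_1^*,\dots,\mathbf x_k^*\in\mathcal S$ with $\mathbf x_1^*\preceq\cdots\preceq\mathbf x_k^*$ that maximize $\sum_{1\le i<j\le k}|\mathbf x_i^*-\mathbf x_j^*|$ over all $k$-tuples $(\mathbf x_1,\dots,\mathbf x_k)\in\mathcal S^k$.
   Context: A double Horn formula is a CNF formula in which every clause contains at most one positive literal and at most one negative literal. For $\mathbf x,\mathbf y\in\{0,1\}^n$, $\mathbf x\preceq\mathbf y$ means $x_i\le y_i$ for all $i$, and $|\mathbf x-\mathbf y|$ is the number of coordinates in which $\mathbf x$ and $\mathbf y$ differ. -}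

module Defs where

open import Data.Nat using (ℕ; zero; suc; _+_; _≤_)
open import Data.Bool using (Bool; true; false; _∨_; not; _≤_)
open import Data.Fin using (Fin)
open import Data.Vec using (Vec; []; _∷_; lookup)
open import Data.List using (List; []; _∷_; length; filter; any)
open import Data.List.Relation.Unary.All using (All)
open import Data.List.Relation.Unary.Any using (Any)
open import Data.Product using (_×_)
open import Relation.Binary.PropositionalEquality using (_≡_)

data Literal (n : ℕ) : Set where
  pos : Fin n → Literal n
  neg : Fin n → Literal n

Clause : ℕ → Set
Clause n = List (Literal n)

CNF : ℕ → Set
CNF n = List (Clause n)

#pos : ∀ {n} → Clause n → ℕ
#pos [] = 0
#pos (pos _ ∷ c) = suc (#pos c)
#pos (neg _ ∷ c) = #pos c

#neg : ∀ {n} → Clause n → ℕ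
#neg [] = 0
#neg (pos _ ∷ c) = #neg c
#neg (neg _ ∷ c) = suc (#neg c)

DoubleHorn : ∀ {n} → CNF n → Set
DoubleHorn φ = All (λ c → (#pos c Data.Nat.≤ 1) × (#neg c Data.Nat.≤ 1)) φ

Assignment : ℕ → Set
Assignment n = Vec Bool n

evalLit : ∀ {n} → Assignment n → Literal n → Bool
evalLit a (pos i) = lookup a i
evalLit a (neg i) = not (lookup a i)

Satisfies : ∀ {n} → Assignment n → CNF n → Set
Satisfies a φ = All (λ c → Any (λ l → evalLit a l ≡ true) c) φ

Satisfiable : ∀ {n} → CNF n → Set
Satisfiable {n} φ = Data.Product.Σ (Assignment n) (λ a → Satisfies a φ)

_⪯_ : ∀ {n} → Vec Bool n → Vec Bool n → Set
x ⪯ y = ∀ i → lookup x i Data.Bool.≤ lookup y i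

dist : ∀ {n} → Vec Bool n → Vec Bool n → ℕ
dist [] [] = 0
dist (true ∷ xs) (true ∷ ys) = dist xs ys
dist (false ∷ xs) (false ∷ ys) = dist xs ys
dist (true ∷ xs) (false ∷ ys) = suc (dist xs ys)
dist (false ∷ xs) (true ∷ ys) = suc (dist xs ys)

distToAll : ∀ {n k} → Vec Bool n → Vec (Vec Bool n) k → ℕ
distToAll x [] = 0
distToAll x (y ∷ ys) = dist x y + distToAll x ys

pairSum : ∀ {n k} → Vec (Vec Bool n) k → ℕ
pairSum [] = 0
pairSum (x ∷ xs) = distToAll x xs + pairSum xs

data Chain {n : ℕ} : ∀ {k} → Vec (Vec Bool n) k → Set where
  []  : Chain []
  [_] : ∀ x → Chain (x ∷ [])
  _∷_ : ∀ {k x y} {ys : Vec (Vec Bool n) k} → x ⪯ y → Chain (y ∷ ys) → Chain (x ∷ y ∷ ys)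

AllSat : ∀ {n k} → CNF n → Vec (Vec Bool n) k → Set
AllSat φ xs = ∀ i → Satisfies (lookup xs i) φ

{-# OPTIONS --safe #-}
-- Horn clauses are preserved by coordinatewise ∧ and dual Horn clauses by coordinatewise ∨,
-- so the models of a double Horn formula form a sublattice of {0,1}ⁿ.  Hamming distance is
-- modular on this lattice: d(w, x∧z) + d(w, x∨z) = d(w, x) + d(w, z) and d(x∧z, x∨z) = d(x, z).
-- Hence replacing a pair (x, z) of a tuple by (x∧z, x∨z) keeps the pairwise distance sum, and
-- repeating this turns any tuple into a chain.  Applied to a maximiser, which exists because
-- there are finitely many tuples, it yields a maximising chain.
module Submission where

open import Defs
open import Data.Nat using (ℕ; suc; _≤_)
open import Data.Bool using (Bool)
open import Data.Vec using (Vec)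
open import Data.Product using (Σ; _×_)

open import Data.Nat using (zero; _+_; s≤s)
open import Data.Nat.Properties using (+-assoc; +-commutativeSemigroup; ≤-trans; ≤-reflexive)
open import Algebra.Properties.CommutativeSemigroup +-commutativeSemigroup using (interchange)
open import Data.Bool using (true; false; _∧_; _∨_; not; _≟_; b≤b; f≤t) renaming (_≤_ to _≤ᵇ_)
open import Data.Fin using (Fin)
open import Data.Fin.Properties using (all?)
open import Data.Vec using ([]; _∷_; lookup; zipWith; replicate)
open import Data.Vec.Properties using (lookup-zipWith; lookup-replicate)
import Data.Bool.Properties as Bool
import Data.Vec.Relation.Unary.All as Vecᴬ
import Data.Vec.Relation.Unary.All.Properties as Vecᴬ
open import Data.List using (List; filter; cartesianProductWith) renaming ([] to []ˡ; _∷_ to _∷ˡ_)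
open import Data.List.Relation.Unary.All as All using (All)
open import Data.List.Relation.Unary.All.Properties using (all-filter)
open import Data.List.Relation.Unary.Any as Any using (Any; here; there)
open import Data.List.Membership.Propositional using (_∈_; _∉_; find; lose)
open import Data.List.Membership.Propositional.Properties using (∈-filter⁺; ∈-cartesianProductWith⁺)
open import Data.List.Extrema.Nat using (argmax; argmax-all; f[xs]≤f[argmax])
open import Data.Product using (∃; ∃-syntax; _,_; proj₁; proj₂)
open import Data.Empty using (⊥-elim)
open import Relation.Nullary using (Dec)
open import Relation.Unary using (Decidable)
open import Relation.Binary.PropositionalEquality using (_≡_; refl; sym; trans; cong; cong₂; subst; module ≡-Reasoning)
open ≡-Reasoning

private
  variable
    n m : ℕ

infixr 7 _⊓_
infixr 6 _⊔_

_⊓_ _⊔_ : Vec Bool n → Vec Bool n → Vec Bool n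
_⊓_ = zipWith _∧_
_⊔_ = zipWith _∨_

bitDist : Bool → Bool → ℕ
bitDist true  true  = 0
bitDist false false = 0
bitDist true  false = 1
bitDist false true  = 1

dist-∷ : ∀ a b (xs ys : Vec Bool n) → dist (a ∷ xs) (b ∷ ys) ≡ bitDist a b + dist xs ys
dist-∷ true  true  xs ys = refl
dist-∷ false false xs ys = refl
dist-∷ true  false xs ys = refl
dist-∷ false true  xs ys = refl

dist-comm : (x y : Vec Bool n) → dist x y ≡ dist y x
dist-comm []          []          = refl
dist-comm (true ∷ x)  (true ∷ y)  = dist-comm x y
dist-comm (false ∷ x) (false ∷ y) = dist-comm x y
dist-comm (true ∷ x)  (false ∷ y) = cong suc (dist-comm x y)
dist-comm (false ∷ x) (true ∷ y)  = cong suc (dist-comm x y)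

bitDist-∧+bitDist-∨ : ∀ a b c → bitDist a (b ∧ c) + bitDist a (b ∨ c) ≡ bitDist a b + bitDist a c
bitDist-∧+bitDist-∨ true  true  true  = refl
bitDist-∧+bitDist-∨ true  true  false = refl
bitDist-∧+bitDist-∨ true  false true  = refl
bitDist-∧+bitDist-∨ true  false false = refl
bitDist-∧+bitDist-∨ false true  true  = refl
bitDist-∧+bitDist-∨ false true  false = refl
bitDist-∧+bitDist-∨ false false true  = refl
bitDist-∧+bitDist-∨ false false false = refl

bitDist[∧,∨]≡bitDist : ∀ a b → bitDist (a ∧ b) (a ∨ b) ≡ bitDist a b
bitDist[∧,∨]≡bitDist true  true  = refl
bitDist[∧,∨]≡bitDist true  false = refl
bitDist[∧,∨]≡bitDist false true  = refl
bitDist[∧,∨]≡bitDist false false = refl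

dist-⊓+dist-⊔ : (w x z : Vec Bool n) → dist w (x ⊓ z) + dist w (x ⊔ z) ≡ dist w x + dist w z
dist-⊓+dist-⊔ []      []      []      = refl
dist-⊓+dist-⊔ (a ∷ w) (b ∷ x) (c ∷ z) = begin
  dist (a ∷ w) ((b ∧ c) ∷ x ⊓ z) + dist (a ∷ w) ((b ∨ c) ∷ x ⊔ z)
    ≡⟨ cong₂ _+_ (dist-∷ a (b ∧ c) w (x ⊓ z)) (dist-∷ a (b ∨ c) w (x ⊔ z)) ⟩
  (bitDist a (b ∧ c) + dist w (x ⊓ z)) + (bitDist a (b ∨ c) + dist w (x ⊔ z))
    ≡⟨ interchange (bitDist a (b ∧ c)) _ _ _ ⟩
  (bitDist a (b ∧ c) + bitDist a (b ∨ c)) + (dist w (x ⊓ z) + dist w (x ⊔ z))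
    ≡⟨ cong₂ _+_ (bitDist-∧+bitDist-∨ a b c) (dist-⊓+dist-⊔ w x z) ⟩
  (bitDist a b + bitDist a c) + (dist w x + dist w z)
    ≡⟨ interchange (bitDist a b) (bitDist a c) _ _ ⟩
  (bitDist a b + dist w x) + (bitDist a c + dist w z)
    ≡⟨ cong₂ _+_ (dist-∷ a b w x) (dist-∷ a c w z) ⟨
  dist (a ∷ w) (b ∷ x) + dist (a ∷ w) (c ∷ z)
    ∎

dist-⊓+dist-⊔ʳ : (w x z : Vec Bool n) → dist (x ⊓ z) w + dist (x ⊔ z) w ≡ dist x w + dist z w
dist-⊓+dist-⊔ʳ w x z = begin
  dist (x ⊓ z) w + dist (x ⊔ z) w ≡⟨ cong₂ _+_ (dist-comm (x ⊓ z) w) (dist-comm (x ⊔ z) w) ⟩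
  dist w (x ⊓ z) + dist w (x ⊔ z) ≡⟨ dist-⊓+dist-⊔ w x z ⟩
  dist w x + dist w z             ≡⟨ cong₂ _+_ (dist-comm w x) (dist-comm w z) ⟩
  dist x w + dist z w             ∎

dist[⊓,⊔]≡dist : (x z : Vec Bool n) → dist (x ⊓ z) (x ⊔ z) ≡ dist x z
dist[⊓,⊔]≡dist []      []      = refl
dist[⊓,⊔]≡dist (b ∷ x) (c ∷ z) = begin
  dist ((b ∧ c) ∷ x ⊓ z) ((b ∨ c) ∷ x ⊔ z)       ≡⟨ dist-∷ (b ∧ c) (b ∨ c) (x ⊓ z) (x ⊔ z) ⟩
  bitDist (b ∧ c) (b ∨ c) + dist (x ⊓ z) (x ⊔ z) ≡⟨ cong₂ _+_ (bitDist[∧,∨]≡bitDist b c) (dist[⊓,⊔]≡dist x z) ⟩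
  bitDist b c + dist x z                         ≡⟨ dist-∷ b c x z ⟨
  dist (b ∷ x) (c ∷ z)                           ∎

distToAll-⊓+distToAll-⊔ : (x z : Vec Bool n) (ys : Vec (Vec Bool n) m) →
  distToAll (x ⊓ z) ys + distToAll (x ⊔ z) ys ≡ distToAll x ys + distToAll z ys
distToAll-⊓+distToAll-⊔ x z []       = refl
distToAll-⊓+distToAll-⊔ x z (y ∷ ys) = begin
  (dist (x ⊓ z) y + distToAll (x ⊓ z) ys) + (dist (x ⊔ z) y + distToAll (x ⊔ z) ys)
    ≡⟨ interchange (dist (x ⊓ z) y) _ _ _ ⟩
  (dist (x ⊓ z) y + dist (x ⊔ z) y) + (distToAll (x ⊓ z) ys + distToAll (x ⊔ z) ys)
    ≡⟨ cong₂ _+_ (dist-⊓+dist-⊔ʳ y x z) (distToAll-⊓+distToAll-⊔ x z ys) ⟩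
  (dist x y + dist z y) + (distToAll x ys + distToAll z ys)
    ≡⟨ interchange (dist x y) (dist z y) _ _ ⟩
  (dist x y + distToAll x ys) + (dist z y + distToAll z ys)
    ∎

-- Unlike ordinary insertion sort, this replaces pairs of entries by their meet and join
-- instead of permuting them.
insert : Vec Bool n → Vec (Vec Bool n) m → Vec (Vec Bool n) (suc m)
insert x []       = x ∷ []
insert x (z ∷ zs) = x ⊓ z ∷ insert (x ⊔ z) zs

sort : Vec (Vec Bool n) m → Vec (Vec Bool n) m
sort []       = []
sort (x ∷ xs) = insert x (sort xs)

distToAll-insert : (w x : Vec Bool n) (zs : Vec (Vec Bool n) m) →
  distToAll w (insert x zs) ≡ distToAll w (x ∷ zs)
distToAll-insert w x []       = refl
distToAll-insert w x (z ∷ zs) = begin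
  dist w (x ⊓ z) + distToAll w (insert (x ⊔ z) zs) ≡⟨ cong (dist w (x ⊓ z) +_) (distToAll-insert w (x ⊔ z) zs) ⟩
  dist w (x ⊓ z) + (dist w (x ⊔ z) + distToAll w zs) ≡⟨ +-assoc (dist w (x ⊓ z)) _ _ ⟨
  (dist w (x ⊓ z) + dist w (x ⊔ z)) + distToAll w zs ≡⟨ cong (_+ distToAll w zs) (dist-⊓+dist-⊔ w x z) ⟩
  (dist w x + dist w z) + distToAll w zs             ≡⟨ +-assoc (dist w x) _ _ ⟩
  dist w x + (dist w z + distToAll w zs)             ∎

pairSum-insert : (x : Vec Bool n) (zs : Vec (Vec Bool n) m) → pairSum (insert x zs) ≡ pairSum (x ∷ zs)
pairSum-insert x []       = refl
pairSum-insert x (z ∷ zs) = begin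
  distToAll (x ⊓ z) (insert (x ⊔ z) zs) + pairSum (insert (x ⊔ z) zs)
    ≡⟨ cong₂ _+_ (distToAll-insert (x ⊓ z) (x ⊔ z) zs) (pairSum-insert (x ⊔ z) zs) ⟩
  (dist (x ⊓ z) (x ⊔ z) + distToAll (x ⊓ z) zs) + (distToAll (x ⊔ z) zs + pairSum zs)
    ≡⟨ +-reassoc (dist (x ⊓ z) (x ⊔ z)) _ _ _ ⟩
  dist (x ⊓ z) (x ⊔ z) + ((distToAll (x ⊓ z) zs + distToAll (x ⊔ z) zs) + pairSum zs)
    ≡⟨ cong₂ (λ d s → d + (s + pairSum zs)) (dist[⊓,⊔]≡dist x z) (distToAll-⊓+distToAll-⊔ x z zs) ⟩
  dist x z + ((distToAll x zs + distToAll z zs) + pairSum zs)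
    ≡⟨ +-reassoc (dist x z) _ _ _ ⟨
  (dist x z + distToAll x zs) + (distToAll z zs + pairSum zs)
    ∎
  where
  +-reassoc : ∀ a b c d → (a + b) + (c + d) ≡ a + ((b + c) + d)
  +-reassoc a b c d = trans (+-assoc a b (c + d)) (cong (a +_) (sym (+-assoc b c d)))

distToAll-sort : (w : Vec Bool n) (xs : Vec (Vec Bool n) m) → distToAll w (sort xs) ≡ distToAll w xs
distToAll-sort w []       = refl
distToAll-sort w (x ∷ xs) = trans (distToAll-insert w x (sort xs)) (cong (dist w x +_) (distToAll-sort w xs))

pairSum-sort : (xs : Vec (Vec Bool n) m) → pairSum (sort xs) ≡ pairSum xs
pairSum-sort []       = refl
pairSum-sort (x ∷ xs) = trans (pairSum-insert x (sort xs)) (cong₂ _+_ (distToAll-sort x xs) (pairSum-sort xs))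

a∧b≤a : ∀ a b → a ∧ b ≤ᵇ a
a∧b≤a true  b = Bool.≤-maximum b
a∧b≤a false b = b≤b

a∧b≤b : ∀ a b → a ∧ b ≤ᵇ b
a∧b≤b true  b = b≤b
a∧b≤b false b = Bool.≤-minimum b

a≤a∨b : ∀ a b → a ≤ᵇ a ∨ b
a≤a∨b true  b = b≤b
a≤a∨b false b = Bool.≤-minimum b

b≤a∨b : ∀ a b → b ≤ᵇ a ∨ b
b≤a∨b true  b = Bool.≤-maximum b
b≤a∨b false b = b≤b

∧-glb : ∀ {a b c} → a ≤ᵇ b → a ≤ᵇ c → a ≤ᵇ b ∧ c
∧-glb {false} _   _   = Bool.≤-minimum _
∧-glb {true}  b≤b b≤b = b≤b

⪯-trans : {x y z : Vec Bool n} → x ⪯ y → y ⪯ z → x ⪯ z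
⪯-trans x⪯y y⪯z i = Bool.≤-trans (x⪯y i) (y⪯z i)

x⊓z⪯x : (x z : Vec Bool n) → (x ⊓ z) ⪯ x
x⊓z⪯x x z i = subst (_≤ᵇ lookup x i) (sym (lookup-zipWith _∧_ i x z)) (a∧b≤a _ _)

x⊓z⪯z : (x z : Vec Bool n) → (x ⊓ z) ⪯ z
x⊓z⪯z x z i = subst (_≤ᵇ lookup z i) (sym (lookup-zipWith _∧_ i x z)) (a∧b≤b _ _)

x⪯x⊔z : (x z : Vec Bool n) → x ⪯ (x ⊔ z)
x⪯x⊔z x z i = subst (lookup x i ≤ᵇ_) (sym (lookup-zipWith _∨_ i x z)) (a≤a∨b _ _)

z⪯x⊔z : (x z : Vec Bool n) → z ⪯ (x ⊔ z)
z⪯x⊔z x z i = subst (lookup z i ≤ᵇ_) (sym (lookup-zipWith _∨_ i x z)) (b≤a∨b _ _)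

⊓-glb : {w x z : Vec Bool n} → w ⪯ x → w ⪯ z → w ⪯ (x ⊓ z)
⊓-glb {w = w} {x} {z} w⪯x w⪯z i =
  subst (lookup w i ≤ᵇ_) (sym (lookup-zipWith _∧_ i x z)) (∧-glb (w⪯x i) (w⪯z i))

x⊓z⪯x⊔z : (x z : Vec Bool n) → (x ⊓ z) ⪯ (x ⊔ z)
x⊓z⪯x⊔z x z = ⪯-trans {x = x ⊓ z} {x} {x ⊔ z} (x⊓z⪯x x z) (x⪯x⊔z x z)

Chain-weakenHead : {w z : Vec Bool n} {zs : Vec (Vec Bool n) m} → w ⪯ z → Chain (z ∷ zs) → Chain (w ∷ zs)
Chain-weakenHead             w⪯z [ _ ]                = [ _ ]
Chain-weakenHead {w = w} {z} w⪯z (_∷_ {y = y} z⪯y c) = ⪯-trans {x = w} {z} {y} w⪯z z⪯y ∷ c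

mutual
  insert-Chain : (x : Vec Bool n) {zs : Vec (Vec Bool n) m} → Chain zs → Chain (insert x zs)
  insert-Chain x {[]}     [] = [ x ]
  insert-Chain x {z ∷ zs} c  = insert-Chain-above (x ⊔ z) zs (x⊓z⪯x⊔z x z) (Chain-weakenHead (x⊓z⪯z x z) c)

  insert-Chain-above : {w : Vec Bool n} (x : Vec Bool n) (zs : Vec (Vec Bool n) m) →
    w ⪯ x → Chain (w ∷ zs) → Chain (w ∷ insert x zs)
  insert-Chain-above           x []       w⪯x [ _ ]       = w⪯x ∷ [ x ]
  insert-Chain-above {w = w} x (z ∷ zs) w⪯x (w⪯z ∷ c) = ⊓-glb {w = w} {x} {z} w⪯x w⪯z ∷ insert-Chain x c

sort-Chain : (xs : Vec (Vec Bool n) m) → Chain (sort xs)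
sort-Chain []       = []
sort-Chain (x ∷ xs) = insert-Chain x (sort-Chain xs)

module _ {P : Vec Bool n → Set}
         (⊓-closed : ∀ {x y} → P x → P y → P (x ⊓ y))
         (⊔-closed : ∀ {x y} → P x → P y → P (x ⊔ y)) where

  insert-All : ∀ {x} {zs : Vec (Vec Bool n) m} → P x → Vecᴬ.All P zs → Vecᴬ.All P (insert x zs)
  insert-All px Vecᴬ.[]          = px Vecᴬ.∷ Vecᴬ.[]
  insert-All px (pz Vecᴬ.∷ pzs) = ⊓-closed px pz Vecᴬ.∷ insert-All (⊔-closed px pz) pzs

  sort-All : {xs : Vec (Vec Bool n) m} → Vecᴬ.All P xs → Vecᴬ.All P (sort xs)
  sort-All Vecᴬ.[]          = Vecᴬ.[]
  sort-All (px Vecᴬ.∷ pxs) = insert-All px (sort-All pxs)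

SatisfiesClause : Assignment n → Clause n → Set
SatisfiesClause a c = Any (λ l → evalLit a l ≡ true) c

true-monotone : ∀ {a b} → a ≤ᵇ b → a ≡ true → b ≡ true
true-monotone b≤b p = p
true-monotone f≤t _ = refl

not-antitone : ∀ {a b} → a ≤ᵇ b → not b ≡ true → not a ≡ true
not-antitone b≤b p  = p
not-antitone f≤t ()

pos-monotone : ∀ {x y : Assignment n} {i} → x ⪯ y → evalLit x (pos i) ≡ true → evalLit y (pos i) ≡ true
pos-monotone {i = i} x⪯y = true-monotone (x⪯y i)

neg-antitone : ∀ {x y : Assignment n} {i} → x ⪯ y → evalLit y (neg i) ≡ true → evalLit x (neg i) ≡ true
neg-antitone {i = i} x⪯y = not-antitone (x⪯y i)

not-∨-true : ∀ {a b} → not a ≡ true → not b ≡ true → not (a ∨ b) ≡ true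
not-∨-true {false} {false} _ _ = refl

pos∉ : ∀ {i : Fin n} (c : Clause n) → #pos c ≤ 0 → pos i ∉ c
pos∉ (pos _ ∷ˡ c) ()
pos∉ (neg _ ∷ˡ c) h (there p) = pos∉ c h p

neg∉ : ∀ {i : Fin n} (c : Clause n) → #neg c ≤ 0 → neg i ∉ c
neg∉ (neg _ ∷ˡ c) ()
neg∉ (pos _ ∷ˡ c) h (there p) = neg∉ c h p

pos-unique : ∀ {i j : Fin n} (c : Clause n) → #pos c ≤ 1 → pos i ∈ c → pos j ∈ c → i ≡ j
pos-unique (pos _ ∷ˡ c) _       (here refl) (here refl) = refl
pos-unique (pos _ ∷ˡ c) (s≤s h) (here refl) (there q)   = ⊥-elim (pos∉ c h q)
pos-unique (pos _ ∷ˡ c) (s≤s h) (there p)   _           = ⊥-elim (pos∉ c h p)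
pos-unique (neg _ ∷ˡ c) h       (there p)   (there q)   = pos-unique c h p q

neg-unique : ∀ {i j : Fin n} (c : Clause n) → #neg c ≤ 1 → neg i ∈ c → neg j ∈ c → i ≡ j
neg-unique (neg _ ∷ˡ c) _       (here refl) (here refl) = refl
neg-unique (neg _ ∷ˡ c) (s≤s h) (here refl) (there q)   = ⊥-elim (neg∉ c h q)
neg-unique (neg _ ∷ˡ c) (s≤s h) (there p)   _           = ⊥-elim (neg∉ c h p)
neg-unique (pos _ ∷ˡ c) h       (there p)   (there q)   = neg-unique c h p q

SatisfiesClause-⊓ : {a b : Assignment n} (c : Clause n) → #pos c ≤ 1 →
  SatisfiesClause a c → SatisfiesClause b c → SatisfiesClause (a ⊓ b) c
SatisfiesClause-⊓ {a = a} {b} c horn sa sb with find sa | find sb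
... | neg i , i∈c , ai | _                = lose i∈c (neg-antitone {x = a ⊓ b} {a} (x⊓z⪯x a b) ai)
... | pos _ , _   , _  | neg j , j∈c , bj = lose j∈c (neg-antitone {x = a ⊓ b} {b} (x⊓z⪯z a b) bj)
... | pos i , i∈c , ai | pos j , j∈c , bj with pos-unique c horn i∈c j∈c
...   | refl = lose i∈c (trans (lookup-zipWith _∧_ i a b) (cong₂ _∧_ ai bj))

SatisfiesClause-⊔ : {a b : Assignment n} (c : Clause n) → #neg c ≤ 1 →
  SatisfiesClause a c → SatisfiesClause b c → SatisfiesClause (a ⊔ b) c
SatisfiesClause-⊔ {a = a} {b} c dual sa sb with find sa | find sb
... | pos i , i∈c , ai | _                = lose i∈c (pos-monotone {x = a} {a ⊔ b} (x⪯x⊔z a b) ai)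
... | neg _ , _   , _  | pos j , j∈c , bj = lose j∈c (pos-monotone {x = b} {a ⊔ b} (z⪯x⊔z a b) bj)
... | neg i , i∈c , ai | neg j , j∈c , bj with neg-unique c dual i∈c j∈c
...   | refl = lose i∈c (trans (cong not (lookup-zipWith _∨_ i a b)) (not-∨-true ai bj))

Satisfies-⊓ : {φ : CNF n} → All (λ c → #pos c ≤ 1) φ → {a b : Assignment n} →
  Satisfies a φ → Satisfies b φ → Satisfies (a ⊓ b) φ
Satisfies-⊓ All.[]               All.[]          All.[]          = All.[]
Satisfies-⊓ (horn All.∷ horns) (sa All.∷ sas) (sb All.∷ sbs) =
  SatisfiesClause-⊓ _ horn sa sb All.∷ Satisfies-⊓ horns sas sbs

Satisfies-⊔ : {φ : CNF n} → All (λ c → #neg c ≤ 1) φ → {a b : Assignment n} →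
  Satisfies a φ → Satisfies b φ → Satisfies (a ⊔ b) φ
Satisfies-⊔ All.[]               All.[]          All.[]          = All.[]
Satisfies-⊔ (dual All.∷ duals) (sa All.∷ sas) (sb All.∷ sbs) =
  SatisfiesClause-⊔ _ dual sa sb All.∷ Satisfies-⊔ duals sas sbs

satisfies? : (φ : CNF n) (a : Assignment n) → Dec (Satisfies a φ)
satisfies? φ a = All.all? (λ c → Any.any? (λ l → evalLit a l ≟ true) c) φ

allSat? : (φ : CNF n) (xs : Vec (Vec Bool n) m) → Dec (AllSat φ xs)
allSat? φ xs = all? (λ i → satisfies? φ (lookup xs i))

replicate-AllSat : {φ : CNF n} {a : Assignment n} → Satisfies a φ → AllSat φ (replicate m a)
replicate-AllSat {φ = φ} {a} sa i = subst (λ v → Satisfies v φ) (sym (lookup-replicate i a)) sa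

vectors : {A : Set} → List A → (m : ℕ) → List (Vec A m)
vectors xs zero    = [] ∷ˡ []ˡ
vectors xs (suc m) = cartesianProductWith _∷_ xs (vectors xs m)

∈-vectors : {A : Set} {xs : List A} → (∀ a → a ∈ xs) → (v : Vec A m) → v ∈ vectors xs m
∈-vectors every []      = here refl
∈-vectors every (a ∷ v) = ∈-cartesianProductWith⁺ _∷_ (every a) (∈-vectors every v)

bools : List Bool
bools = true ∷ˡ false ∷ˡ []ˡ

∈-bools : ∀ b → b ∈ bools
∈-bools true  = here refl
∈-bools false = there (here refl)

tuples : (n m : ℕ) → List (Vec (Vec Bool n) m)
tuples n m = vectors (vectors bools n) m

∈-tuples : (xs : Vec (Vec Bool n) m) → xs ∈ tuples n m
∈-tuples = ∈-vectors (∈-vectors ∈-bools)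

maximiser : {A : Set} {P : A → Set} → Decidable P → (xs : List A) → (∀ a → a ∈ xs) →
  (f : A → ℕ) → ∃ P → ∃[ a ] P a × (∀ b → P b → f b ≤ f a)
maximiser {A = A} {P = P} P? xs every f (a , pa) =
  best , argmax-all f {P = P} pa (all-filter P? xs) ,
  λ b pb → All.lookup (f[xs]≤f[argmax] a candidates) (∈-filter⁺ P? (every b) pb)
  where
  candidates : List A
  candidates = filter P? xs

  best : A
  best = argmax f a candidates

lemma4 : (n k : ℕ) (φ : CNF n) → DoubleHorn φ → Satisfiable φ →
    Σ (Vec (Vec Bool n) (suc k)) (λ xs →
    AllSat φ xs × Chain xs ×
    ((ys : Vec (Vec Bool n) (suc k)) → AllSat φ ys → pairSum ys ≤ pairSum xs))
lemma4 n k φ doubleHorn (a , sa)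
  with xs , xs-sat , xs-max ← maximiser (allSat? φ) (tuples n (suc k)) ∈-tuples pairSum
                                        (replicate (suc k) a , replicate-AllSat sa)
  = sort xs
  , Vecᴬ.lookup⁺ (sort-All {P = λ v → Satisfies v φ}
                           (Satisfies-⊓ (All.map proj₁ doubleHorn)) (Satisfies-⊔ (All.map proj₂ doubleHorn))
                           (Vecᴬ.lookup⁻ {xs = xs} xs-sat))
  , sort-Chain xs
  , λ ys ys-sat → ≤-trans (xs-max ys ys-sat) (≤-reflexive (sym (pairSum-sort xs)))
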